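{- Let $G$ be a finite simple graph with $n$ vertices. Then for every natural number $s\geq2$, $$\varphi^{(s)}(G)\geq\frac{n}{n-D_2(G)}.$$
   Context: Let $d(v)$ denote the degree of $v$. For nonempty $W\subseteq V(G)$ and natural $k$, $D_k(W)=\left(\frac{1}{|W|}\sum_{v\in W}d^k(v)\right)^{1/k}$ and $D_k(G)=D_k(V(G))$. $W$ is a $\delta_k$-small set if $D_k(W)\leq n-|W|$. $\varphi^{(s)}(G)$ is the smallest natural number $r$ such that $V(G)$ is a disjoint union of $r$ $\delta_s$-small sets. -}

module Defs where

open import Data.Nat using (ℕ; zero; suc; _+_; _*_; _∸_; _^_; _≤_)
open import Data.Fin using (Fin; zero; suc; _≟_)
open import Data.Bool using (Bool; true; false; if_then_else_)
open import Data.Product using (Σ; _×_)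
open import Relation.Nullary.Decidable using (⌊_⌋)
open import Relation.Binary.PropositionalEquality using (_≡_)

sumFin : ∀ {n} → (Fin n → ℕ) → ℕ
sumFin {zero}  f = 0
sumFin {suc n} f = f zero + sumFin {n} (λ i → f (suc i))

record SimpleGraph (n : ℕ) : Set where
  field
    adj   : Fin n → Fin n → Bool
    sym   : ∀ u v → adj u v ≡ adj v u
    irrefl : ∀ v → adj v v ≡ false

open SimpleGraph public

deg : ∀ {n} → SimpleGraph n → Fin n → ℕ
deg G v = sumFin (λ u → if adj G v u then 1 else 0)

-- A partition of V(G) into r parts is encoded by a part-assignment map
-- f : Fin n → Fin r; part i is W_i = { v | f v = i }.
inPart : ∀ {n r} → (Fin n → Fin r) → Fin r → Fin n → Bool
inPart f i v = ⌊ f v ≟ i ⌋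

partSize : ∀ {n r} → (Fin n → Fin r) → Fin r → ℕ
partSize f i = sumFin (λ v → if inPart f i v then 1 else 0)

partPowSum : ∀ {n r} → SimpleGraph n → ℕ → (Fin n → Fin r) → Fin r → ℕ
partPowSum G k f i = sumFin (λ v → if inPart f i v then deg G v ^ k else 0)

-- W_i is nonempty and δ_k-small:  D_k(W) ≤ n - |W|, i.e.
--   ((1/|W|) Σ_{v∈W} d(v)^k)^{1/k} ≤ n - |W|
-- which (both sides nonnegative, x ↦ x^k monotone) is equivalent to
--   Σ_{v∈W} d(v)^k ≤ |W| · (n - |W|)^k.
IsSmallPart : ∀ {n r} → SimpleGraph n → ℕ → (Fin n → Fin r) → Fin r → Set
IsSmallPart {n} G k f i =
  (1 ≤ partSize f i) × (partPowSum G k f i ≤ partSize f i * (n ∸ partSize f i) ^ k)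

SmallPartition : ∀ {n} → SimpleGraph n → ℕ → ℕ → Set
SmallPartition {n} G k r = Σ (Fin n → Fin r) (λ f → ∀ i → IsSmallPart G k f i)

IsPhi : ∀ {n} → SimpleGraph n → ℕ → ℕ → Set
IsPhi G k r = SmallPartition G k r × (∀ r' → SmallPartition G k r' → r ≤ r')

-- n · D_2(G)^2 = Σ_v d(v)^2
degSqSum : ∀ {n} → SimpleGraph n → ℕ
degSqSum G = sumFin (λ v → deg G v ^ 2)

{-# OPTIONS --safe #-}
-- A δ_s-small part W with a = |W| and m = n - a satisfies Σ_{v∈W} d(v)^s ≤ a m^s, hence by the
-- power mean inequality (pointwise: the weighted Young inequality s m^(s-2) d² ≤ 2 d^s + (s-2) m^s)
-- also Σ_{v∈W} d(v)² ≤ a m².  Summing over the φ parts gives Σ_v d(v)² ≤ Σ_i a_i (n - a_i)² with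
-- Σ_i a_i = n, and the tangent line of a ↦ a (n - a)² at the balanced point a = n/φ bounds the
-- right-hand side by (φ - 1)² n³ / φ².
module Submission where

open import Defs hiding (sym)
open import Data.Nat using (ℕ; zero; suc; _+_; _*_; _∸_; _^_; _≤_; z≤n; s≤s)
open import Data.Nat.Properties hiding (_≟_)
open import Data.Nat.Tactic.RingSolver using (solve-∀)
open import Data.Fin using (Fin; zero; suc; _≟_)
open import Data.Bool using (true; false; if_then_else_)
open import Data.Product using (_,_)
open import Data.Sum using (inj₁; inj₂)
open import Data.Vec.Functional using (Vector)
open import Relation.Nullary.Decidable using (⌊_⌋; yes; no)
open import Relation.Binary.PropositionalEquality
open import Algebra.Properties.Semiring.Sum +-*-semiring

sumFin≡sum : ∀ {n} (f : Vector ℕ n) → sumFin f ≡ sum f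
sumFin≡sum {zero}  f = refl
sumFin≡sum {suc n} f = cong (f zero +_) (sumFin≡sum (λ i → f (suc i)))

sum-mono-≤ : ∀ {n} {f g : Vector ℕ n} → (∀ i → f i ≤ g i) → sum f ≤ sum g
sum-mono-≤ {zero}  f≤g = z≤n
sum-mono-≤ {suc n} f≤g = +-mono-≤ (f≤g zero) (sum-mono-≤ (λ i → f≤g (suc i)))

sum-const : ∀ n c → ∑[ i < n ] c ≡ n * c
sum-const zero    c = refl
sum-const (suc n) c = cong (c +_) (sum-const n c)

sum-affine : ∀ {r} (a : Vector ℕ r) (β α : ℕ) → ∑[ i < r ] (β + α * a i) ≡ r * β + α * sum a
sum-affine {r} a β α = begin
  ∑[ i < r ] (β + α * a i)            ≡⟨ ∑-distrib-+ (λ _ → β) (λ i → α * a i) ⟩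
  ∑[ i < r ] β + ∑[ i < r ] (α * a i) ≡⟨ cong₂ _+_ (sum-const r β) (sym (*-distribˡ-sum α a)) ⟩
  r * β + α * sum a ∎
  where open ≡-Reasoning

sum-affine-≤ : ∀ {r} (g a : Vector ℕ r) (β α γ δ : ℕ) →
  (∀ i → g i + (β + α * a i) ≤ γ + δ * a i) →
  sum g + (r * β + α * sum a) ≤ r * γ + δ * sum a
sum-affine-≤ {r} g a β α γ δ bound = begin
  sum g + (r * β + α * sum a)            ≡⟨ cong (sum g +_) (sum-affine a β α) ⟨
  sum g + ∑[ i < r ] (β + α * a i)       ≡⟨ ∑-distrib-+ g (λ i → β + α * a i) ⟨
  ∑[ i < r ] (g i + (β + α * a i))       ≤⟨ sum-mono-≤ bound ⟩
  ∑[ i < r ] (γ + δ * a i)               ≡⟨ sum-affine a γ δ ⟩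
  r * γ + δ * sum a ∎
  where open ≤-Reasoning

≤-sum : ∀ {r} (a : Vector ℕ (suc r)) i → a i ≤ sum a
≤-sum a i = subst (a i ≤_) (sym (sum-remove {i = i} a)) (m≤m+n (a i) _)

∑-δ : ∀ {r} (j : Fin r) → sum (λ i → if ⌊ j ≟ i ⌋ then 1 else 0) ≡ 1
∑-δ {suc r} zero    = cong suc (sum-replicate-zero r)
∑-δ {suc r} (suc j) = trans (sum-cong-≗ (λ i → cong (if_then 1 else 0) (⌊suc≟suc⌋ j i))) (∑-δ j)
  where
  ⌊suc≟suc⌋ : ∀ {r} (j i : Fin r) → ⌊ suc j ≟ suc i ⌋ ≡ ⌊ j ≟ i ⌋
  ⌊suc≟suc⌋ j i with j ≟ i
  ... | yes _ = refl
  ... | no _  = refl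

*-rearrangement-≤ : ∀ {a b c d} → a ≤ b → c ≤ d → a * d + b * c ≤ a * c + b * d
*-rearrangement-≤ {a} {b} {c} {d} a≤b c≤d
  with e , refl ← m≤n⇒∃[o]m+o≡n a≤b | f , refl ← m≤n⇒∃[o]m+o≡n c≤d =
  ≤-trans (m≤m+n _ (e * f)) (≤-reflexive (expand a c e f))
  where
  expand : ∀ a c e f → a * (c + f) + (a + e) * c + e * f ≡ a * c + (a + e) * (c + f)
  expand = solve-∀

^-rearrangement-≤ : ∀ x y p q → x ^ p * y ^ q + y ^ p * x ^ q ≤ x ^ (p + q) + y ^ (p + q)
^-rearrangement-≤ x y p q rewrite ^-distribˡ-+-* x p q | ^-distribˡ-+-* y p q with ≤-total x y
... | inj₁ x≤y = *-rearrangement-≤ (^-monoˡ-≤ p x≤y) (^-monoˡ-≤ q x≤y)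
... | inj₂ y≤x = subst₂ _≤_ (+-comm (y ^ p * x ^ q) _) (+-comm (y ^ p * y ^ q) _)
                   (*-rearrangement-≤ (^-monoˡ-≤ p y≤x) (^-monoˡ-≤ q y≤x))

2*m*n≤m^2+n^2 : ∀ m n → 2 * m * n ≤ m ^ 2 + n ^ 2
2*m*n≤m^2+n^2 m n = subst (_≤ m ^ 2 + n ^ 2) (simplify m n) (^-rearrangement-≤ m n 1 1)
  where
  simplify : ∀ m n → m * 1 * (n * 1) + n * 1 * (m * 1) ≡ 2 * m * n
  simplify = solve-∀

-- The ring solver accepts no exponents, so in its lemmas powers are unfolded (x ^ 2 = x * (x * 1))
-- and M, D stand for m ^ t, d ^ t.
young-step : ∀ t m d → m ^ suc t * d ^ 2 + 2 * m * d ^ (2 + t) ≤ 2 * d ^ (3 + t) + m ^ (3 + t)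
young-step t m d = +-cancelʳ-≤ (m ^ 2 * d ^ suc t) _ _ (begin
  m ^ suc t * d ^ 2 + 2 * m * d ^ (2 + t) + m ^ 2 * d ^ suc t
    ≡⟨ regroup m d (m ^ t) (d ^ t) ⟩
  (m ^ 2 * d ^ suc t + d ^ 2 * m ^ suc t) + d ^ suc t * (2 * m * d)
    ≤⟨ +-mono-≤ (^-rearrangement-≤ m d 2 (suc t)) (*-monoʳ-≤ (d ^ suc t) (2*m*n≤m^2+n^2 m d)) ⟩
  (m ^ (3 + t) + d ^ (3 + t)) + d ^ suc t * (m ^ 2 + d ^ 2)
    ≡⟨ collect m d (m ^ t) (d ^ t) ⟩
  2 * d ^ (3 + t) + m ^ (3 + t) + m ^ 2 * d ^ suc t ∎)
  where
  open ≤-Reasoning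
  regroup : ∀ m d M D →
    m * M * (d * (d * 1)) + 2 * m * (d * (d * D)) + m * (m * 1) * (d * D)
      ≡ (m * (m * 1) * (d * D) + d * (d * 1) * (m * M)) + d * D * (2 * m * d)
  regroup = solve-∀
  collect : ∀ m d M D →
    (m * (m * (m * M)) + d * (d * (d * D))) + d * D * (m * (m * 1) + d * (d * 1))
      ≡ 2 * (d * (d * (d * D))) + m * (m * (m * M)) + m * (m * 1) * (d * D)
  collect = solve-∀

young : ∀ t m d → (2 + t) * m ^ t * d ^ 2 ≤ 2 * d ^ (2 + t) + t * m ^ (2 + t)
young zero    m d = ≤-reflexive (base d)
  where
  base : ∀ d → 2 * 1 * (d * (d * 1)) ≡ 2 * (d * (d * 1)) + 0
  base = solve-∀
young (suc t) m d = begin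
  (3 + t) * m ^ suc t * d ^ 2
    ≡⟨ split t m (m ^ t) d ⟩
  m * ((2 + t) * m ^ t * d ^ 2) + m ^ suc t * d ^ 2
    ≤⟨ +-monoˡ-≤ _ (*-monoʳ-≤ m (young t m d)) ⟩
  m * (2 * d ^ (2 + t) + t * m ^ (2 + t)) + m ^ suc t * d ^ 2
    ≡⟨ regroup t m (m ^ t) d (d ^ t) ⟩
  t * m ^ (3 + t) + (m ^ suc t * d ^ 2 + 2 * m * d ^ (2 + t))
    ≤⟨ +-monoʳ-≤ (t * m ^ (3 + t)) (young-step t m d) ⟩
  t * m ^ (3 + t) + (2 * d ^ (3 + t) + m ^ (3 + t))
    ≡⟨ collect t m (m ^ t) d (d ^ t) ⟩
  2 * d ^ (3 + t) + suc t * m ^ (3 + t) ∎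
  where
  open ≤-Reasoning
  split : ∀ t m M d → (3 + t) * (m * M) * (d * (d * 1)) ≡ m * ((2 + t) * M * (d * (d * 1))) + m * M * (d * (d * 1))
  split = solve-∀
  regroup : ∀ t m M d D →
    m * (2 * (d * (d * D)) + t * (m * (m * M))) + m * M * (d * (d * 1))
      ≡ t * (m * (m * (m * M))) + (m * M * (d * (d * 1)) + 2 * m * (d * (d * D)))
  regroup = solve-∀
  collect : ∀ t m M d D →
    t * (m * (m * (m * M))) + (2 * (d * (d * (d * D))) + m * (m * (m * M)))
      ≡ 2 * (d * (d * (d * D))) + suc t * (m * (m * (m * M)))
  collect = solve-∀

^2≤^[2+t] : ∀ t d → d ^ 2 ≤ d ^ (2 + t)
^2≤^[2+t] t zero    = z≤n
^2≤^[2+t] t (suc k) = ^-monoʳ-≤ (suc k) (m≤m+n 2 t)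

power-mean-≤ : ∀ {n} t m (w d : Vector ℕ n) →
  ∑[ v < n ] (w v * d v ^ (2 + t)) ≤ sum w * m ^ (2 + t) →
  ∑[ v < n ] (w v * d v ^ 2) ≤ sum w * m ^ 2
power-mean-≤ t zero w d hyp =
  ≤-trans (sum-mono-≤ (λ v → *-monoʳ-≤ (w v) (^2≤^[2+t] t (d v)))) hyp
power-mean-≤ {n} t m@(suc _) w d hyp = *-cancelˡ-≤ c {{m*n≢0 (2 + t) (m ^ t) {{_}} {{m^n≢0 m t}}}} (begin
  c * ∑[ v < n ] (w v * d v ^ 2)
    ≡⟨ *-distribˡ-sum c (λ v → w v * d v ^ 2) ⟩
  ∑[ v < n ] (c * (w v * d v ^ 2))
    ≤⟨ sum-mono-≤ (λ v → weighted-young (w v) (d v)) ⟩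
  ∑[ v < n ] (2 * (w v * d v ^ (2 + t)) + K * w v)
    ≡⟨ ∑-distrib-+ (λ v → 2 * (w v * d v ^ (2 + t))) (λ v → K * w v) ⟩
  ∑[ v < n ] (2 * (w v * d v ^ (2 + t))) + ∑[ v < n ] (K * w v)
    ≡⟨ cong₂ _+_ (*-distribˡ-sum 2 (λ v → w v * d v ^ (2 + t))) (*-distribˡ-sum K w) ⟨
  2 * ∑[ v < n ] (w v * d v ^ (2 + t)) + K * sum w
    ≤⟨ +-monoˡ-≤ (K * sum w) (*-monoʳ-≤ 2 hyp) ⟩
  2 * (sum w * m ^ (2 + t)) + K * sum w
    ≡⟨ collect t m (m ^ t) (sum w) ⟩
  c * (sum w * m ^ 2) ∎)
  where
  open ≤-Reasoning
  c K : ℕ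
  c = (2 + t) * m ^ t
  K = t * m ^ (2 + t)
  weighted-young : ∀ x e → c * (x * e ^ 2) ≤ 2 * (x * e ^ (2 + t)) + K * x
  weighted-young x e = begin
    c * (x * e ^ 2)                  ≡⟨ *-assoc c x _ ⟨
    c * x * e ^ 2                    ≡⟨ cong (_* e ^ 2) (*-comm c x) ⟩
    x * c * e ^ 2                    ≡⟨ *-assoc x c _ ⟩
    x * (c * e ^ 2)                  ≤⟨ *-monoʳ-≤ x (young t m e) ⟩
    x * (2 * e ^ (2 + t) + K)        ≡⟨ distribute x (e ^ (2 + t)) K ⟩
    2 * (x * e ^ (2 + t)) + K * x ∎
    where
    distribute : ∀ x E K → x * (2 * E + K) ≡ 2 * (x * E) + K * x
    distribute = solve-∀
  collect : ∀ t m M W → 2 * (W * (m * (m * M))) + t * (m * (m * M)) * W ≡ (2 + t) * M * (W * (m * (m * 1)))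
  collect = solve-∀

-- R³ times the tangent line of a ↦ a (N ∸ a)² at a = N / R (with R = 2 + q), all negative terms moved
-- across.  The gap is (R a - N)² X with X = R M + q N; to avoid subtraction, 2 (R a) N X is added to
-- both sides and bounded by ((R a)² + N²) X on the left.
tangent-line : ∀ q N a → a ≤ N →
  (2 + q) ^ 3 * (a * (N ∸ a) ^ 2) + (N ^ 2 * (1 + q) * (q * N) + N ^ 2 * (1 + q) * (2 + q) * a)
    ≤ (N ^ 3 * (1 + q) ^ 2 + N ^ 2 * (1 + q) * N) + N ^ 2 * (1 + q) * q * (2 + q) * a
tangent-line q N a a≤N with M , refl ← m≤n⇒∃[o]m+o≡n a≤N rewrite m+n∸m≡n a M =
  +-cancelʳ-≤ (2 * (R * a) * N * X) _ _ (begin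
    lhs + 2 * (R * a) * N * X                 ≤⟨ +-monoʳ-≤ lhs (*-monoˡ-≤ X (2*m*n≤m^2+n^2 (R * a) N)) ⟩
    lhs + ((R * a) ^ 2 + N ^ 2) * X           ≡⟨ identity q a M ⟩
    rhs + 2 * (R * a) * N * X ∎)
  where
  open ≤-Reasoning
  R X lhs rhs : ℕ
  R = 2 + q
  X = R * M + q * N
  lhs = R ^ 3 * (a * M ^ 2) + (N ^ 2 * (1 + q) * (q * N) + N ^ 2 * (1 + q) * R * a)
  rhs = (N ^ 3 * (1 + q) ^ 2 + N ^ 2 * (1 + q) * N) + N ^ 2 * (1 + q) * q * R * a
  identity : ∀ q a M → let R = 2 + q ; N = a + M ; X = R * M + q * N in
    R * (R * (R * 1)) * (a * (M * (M * 1))) + (N * (N * 1) * (1 + q) * (q * N) + N * (N * 1) * (1 + q) * R * a)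
      + ((R * a) * ((R * a) * 1) + N * (N * 1)) * X
    ≡ (N * (N * (N * 1)) * ((1 + q) * ((1 + q) * 1)) + N * (N * 1) * (1 + q) * N) + N * (N * 1) * (1 + q) * q * R * a
      + 2 * (R * a) * N * X
  identity = solve-∀

composition-bound : ∀ r (a : Vector ℕ r) {n} → sum a ≡ n →
  r ^ 2 * ∑[ i < r ] (a i * (n ∸ a i) ^ 2) ≤ (r ∸ 1) ^ 2 * n ^ 3
composition-bound zero a refl = z≤n
composition-bound 1 a refl rewrite +-identityʳ (a zero) | n∸n≡0 (a zero) | *-zeroʳ (a zero) = z≤n
-- Summed over the r = R parts, the terms of tangent-line that are linear in a i cancel since ∑ a = n.
composition-bound (suc (suc q)) a refl = *-cancelˡ-≤ R (+-cancelʳ-≤ common _ _ (begin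
  R * (R ^ 2 * sum F) + common     ≡⟨ cong (_+ common) (trans (cube R (sum F)) (*-distribˡ-sum (R ^ 3) F)) ⟩
  sum g + (R * β + α * n)          ≤⟨ sum-affine-≤ g a β α γ δ (λ i → tangent-line q n (a i) (≤-sum a i)) ⟩
  R * γ + δ * n                    ≡⟨ collect R k q n (n ^ 3) ((1 + q) ^ 2) ⟩
  R * ((1 + q) ^ 2 * n ^ 3) + common ∎))
  where
  open ≤-Reasoning
  R n k β α γ δ common : ℕ
  F g : Vector ℕ (2 + q)
  R = 2 + q
  n = sum a
  F i = a i * (n ∸ a i) ^ 2
  k = n ^ 2 * (1 + q)
  g i = R ^ 3 * F i
  β = k * (q * n)
  α = k * R
  γ = n ^ 3 * (1 + q) ^ 2 + k * n
  δ = k * q * R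
  common = R * β + α * n
  cube : ∀ R S → R * (R * (R * 1) * S) ≡ R * (R * (R * 1)) * S
  cube = solve-∀
  collect : ∀ R k q n n³ c → R * (n³ * c + k * n) + k * q * R * n ≡ R * (c * n³) + (R * (k * (q * n)) + k * R * n)
  collect = solve-∀

partIndicator : ∀ {n r} → (Fin n → Fin r) → Fin r → Vector ℕ n
partIndicator f i v = if inPart f i v then 1 else 0

∑-partIndicator : ∀ {n r} (f : Fin n → Fin r) (g : Vector ℕ n) →
  ∑[ i < r ] ∑[ v < n ] (partIndicator f i v * g v) ≡ sum g
∑-partIndicator {n} {r} f g = begin
  ∑[ i < r ] ∑[ v < n ] (partIndicator f i v * g v)    ≡⟨ ∑-comm (λ i v → partIndicator f i v * g v) ⟩
  ∑[ v < n ] ∑[ i < r ] (partIndicator f i v * g v)    ≡⟨ sum-cong-≗ (λ v → *-distribʳ-sum (g v) (λ i → partIndicator f i v)) ⟨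
  ∑[ v < n ] (∑[ i < r ] partIndicator f i v * g v)    ≡⟨ sum-cong-≗ (λ v → cong (_* g v) (∑-δ (f v))) ⟩
  ∑[ v < n ] (1 * g v)                                 ≡⟨ sum-cong-≗ (λ v → *-identityˡ (g v)) ⟩
  sum g ∎
  where open ≡-Reasoning

∑-partSize : ∀ {n r} (f : Fin n → Fin r) → ∑[ i < r ] partSize f i ≡ n
∑-partSize {n} {r} f = begin
  ∑[ i < r ] partSize f i                   ≡⟨ sum-cong-≗ (λ i → sumFin≡sum (partIndicator f i)) ⟩
  ∑[ i < r ] ∑[ v < n ] partIndicator f i v ≡⟨ ∑-comm (partIndicator f) ⟩
  ∑[ v < n ] ∑[ i < r ] partIndicator f i v ≡⟨ sum-cong-≗ (λ v → ∑-δ (f v)) ⟩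
  ∑[ v < n ] 1                              ≡⟨ sum-const n 1 ⟩
  n * 1                                     ≡⟨ *-identityʳ n ⟩
  n ∎
  where open ≡-Reasoning

partPowSum≡ : ∀ {n r} (G : SimpleGraph n) k (f : Fin n → Fin r) i →
  partPowSum G k f i ≡ ∑[ v < n ] (partIndicator f i v * deg G v ^ k)
partPowSum≡ G k f i = begin
  partPowSum G k f i                                  ≡⟨ sumFin≡sum (λ v → if inPart f i v then deg G v ^ k else 0) ⟩
  ∑[ v < _ ] (if inPart f i v then deg G v ^ k else 0) ≡⟨ sum-cong-≗ (λ v → if-then-else-0 (inPart f i v) (deg G v ^ k)) ⟩
  ∑[ v < _ ] (partIndicator f i v * deg G v ^ k) ∎
  where
  open ≡-Reasoning
  if-then-else-0 : ∀ b x → (if b then x else 0) ≡ (if b then 1 else 0) * x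
  if-then-else-0 true  x = sym (+-identityʳ x)
  if-then-else-0 false x = refl

smallPart-degSq-≤ : ∀ {n r} (G : SimpleGraph n) t (f : Fin n → Fin r) i → IsSmallPart G (2 + t) f i →
  ∑[ v < n ] (partIndicator f i v * deg G v ^ 2) ≤ partSize f i * (n ∸ partSize f i) ^ 2
smallPart-degSq-≤ {n} G t f i (_ , small) =
  subst (λ W → ∑[ v < n ] (partIndicator f i v * deg G v ^ 2) ≤ W * m ^ 2) (sym size≡)
    (power-mean-≤ t m (partIndicator f i) (deg G)
      (subst₂ _≤_ (partPowSum≡ G (2 + t) f i) (cong (_* m ^ (2 + t)) size≡) small))
  where
  m : ℕ
  m = n ∸ partSize f i
  size≡ : partSize f i ≡ sum (partIndicator f i)
  size≡ = sumFin≡sum (partIndicator f i)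
degSqSum-≤ : ∀ {n r} (G : SimpleGraph n) t (f : Fin n → Fin r) → (∀ i → IsSmallPart G (2 + t) f i) →
  degSqSum G ≤ ∑[ i < r ] (partSize f i * (n ∸ partSize f i) ^ 2)
degSqSum-≤ {n} {r} G t f small = begin
  degSqSum G                                                ≡⟨ sumFin≡sum (λ v → deg G v ^ 2) ⟩
  ∑[ v < n ] (deg G v ^ 2)                                  ≡⟨ ∑-partIndicator f (λ v → deg G v ^ 2) ⟨
  ∑[ i < r ] ∑[ v < n ] (partIndicator f i v * deg G v ^ 2) ≤⟨ sum-mono-≤ (λ i → smallPart-degSq-≤ G t f i (small i)) ⟩
  ∑[ i < r ] (partSize f i * (n ∸ partSize f i) ^ 2) ∎
  where open ≤-Reasoning

corollary4p2 : ∀ {n} (G : SimpleGraph n) (s : ℕ) → 2 ≤ s →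
    ∀ (φ : ℕ) → IsPhi G s φ →
    φ ^ 2 * degSqSum G ≤ (φ ∸ 1) ^ 2 * n ^ 3
corollary4p2 G (suc (suc t)) (s≤s (s≤s z≤n)) φ ((f , small) , _) =
  ≤-trans (*-monoʳ-≤ (φ ^ 2) (degSqSum-≤ G t f small))
          (composition-bound φ (partSize f) (∑-partSize f))
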